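{- Let $n,k\ge1$, let $(e_1,\dots,e_k)$ be non-negative integers with $\sum_i e_i=\binom n2$, and run the standard colouring procedure on $K_n$ with respect to $(e_1,\dots,e_k)$. Let $m\ge 2$, suppose $K_m\in S_\ell$, and suppose the cushion for $K_m$, namely $\sum_{j=1}^k e_{\ell,j}-\binom m2$, is at least $\min\{\tfrac12(k^2-k),\,km\}$. Then $m-1$ consecutive simple colouring steps can be performed on $K_m$ (first on $K_m$, then on the resulting $K_{m-1}$, and so on down to $K_2$), thereby producing a simple colouring of $K_m$.
   Context: Standard colouring procedure: start with the multiset $S_0=\{K_n\}$ and budgets $e_{0,j}=e_j$. At step $\ell\ge0$: if every member of $S_\ell$ is a $K_1$, stop. Otherwise choose $K_p\in S_\ell$ with $p\ge2$, a colour $i\in[k]$ and $1\le t\le\lfloor p/2\rfloor$ with $t(p-t)\le e_{\ell,i}$; split $K_p$ into vertex-disjoint $K_t$ and $K_{p-t}$, colour all $t(p-t)$ edges between them with colour $i$, set $S_{\ell+1}=(S_\ell\setminus\{K_p\})\cup\{K_t,K_{p-t}\}$ (as multisets), $e_{\ell+1,i}=e_{\ell,i}-t(p-t)$ and $e_{\ell+1,j}=e_{\ell,j}$ for $j\neq i$. This is a standard colouring step of size $t$; a simple colouring step is one of size $1$ (it splits $K_p$ into $K_1$ and $K_{p-1}$ using a colour with remaining budget at least $p-1$). A simple colouring of $K_m$ is a colouring of all its edges obtained by a sequence of simple colouring steps. -}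

module Defs where

open import Data.Nat using (ℕ; zero; suc; _+_; _*_; _∸_; _≤_; _⊓_)
open import Data.Nat.Combinatorics using (_C_)
open import Data.Fin using (Fin)
open import Data.Vec using (Vec; lookup; updateAt; sum)
open import Data.List using (List; _∷_; [_])
open import Data.List.Membership.Propositional using (_∈_)
open import Data.List.Relation.Binary.Permutation.Propositional using (_↭_)
open import Data.Product using (_×_)
open import Relation.Binary.Construct.Closure.ReflexiveTransitive using (Star)

-- A state of the standard colouring procedure with k colours:
-- the multiset S_ℓ of clique sizes (a list, taken up to permutation)
-- and the vector of remaining budgets (e_{ℓ,1},…,e_{ℓ,k}).
record State (k : ℕ) : Set where
  constructor ⟨_,_⟩
  field
    cliques : List ℕ
    budget  : Vec ℕ k
open State public

-- One standard colouring step: choose K_p ∈ S (S ↭ p ∷ R), a colour i and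
-- 1 ≤ t ≤ ⌊p/2⌋ (i.e. 2t ≤ p) with t(p−t) ≤ e_i; replace K_p by K_t, K_{p−t}
-- and subtract t(p−t) from the budget of colour i.
data StdStep {k : ℕ} : State k → State k → Set where
  split : (S R : List ℕ) (e : Vec ℕ k) (p t : ℕ) (i : Fin k) →
          S ↭ (p ∷ R) → 1 ≤ t → t + t ≤ p → t * (p ∸ t) ≤ lookup e i →
          StdStep ⟨ S , e ⟩ ⟨ t ∷ (p ∸ t) ∷ R , updateAt e i (λ x → x ∸ t * (p ∸ t)) ⟩

StdReach : {k : ℕ} → State k → State k → Set
StdReach = Star StdStep

initial : (n k : ℕ) → Vec ℕ k → State k
initial n k e = ⟨ [ n ] , e ⟩

-- SimpleRun p e : starting from budgets e, simple colouring steps can be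
-- performed consecutively on K_p, then K_{p−1}, …, down to K_2
-- (splitting K_{q+1} into K_1 and K_q uses a colour with budget ≥ q).
data SimpleRun {k : ℕ} : ℕ → Vec ℕ k → Set where
  done : {e : Vec ℕ k} → SimpleRun 1 e
  step : {q : ℕ} {e : Vec ℕ k} (i : Fin k) → q ≤ lookup e i →
         SimpleRun q (updateAt e i (λ x → x ∸ q)) →
         SimpleRun (suc q) e

-- Only the current budgets matter. Call qC2 + min{kC2, kq} the budget required for K_q; note (k² − k)/2 = kC2.
-- If the total budget meets the requirement for K_{q+1}, some colour has budget at
-- least q: otherwise the total is at most k(q − 1), which is too small, trivially when
-- the minimum is k(q+1) and by 2kq ≤ q² + k² when it is kC2. Splitting off a K_1 with
-- that colour spends q, while the requirement drops by (q+1)C2 − qC2 = q or more, so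
-- the requirement for K_q is met and the argument repeats down to K_1.
module Submission where

open import Defs
open import Data.Nat using (ℕ; suc; _+_; _*_; _∸_; _≤_; _⊓_; _/_)
open import Data.Nat.Combinatorics using (_C_)
open import Data.Vec using (Vec; sum)
open import Data.List.Membership.Propositional using (_∈_)
open import Relation.Binary.PropositionalEquality using (_≡_)

open import Data.Nat using (zero; _<_; z≤n; s≤s; _≤?_)
open import Data.Nat.Properties
open import Data.Nat.DivMod using (m*n/n≡m)
open import Data.Nat.Combinatorics using (nC1≡n; nCk+nC[k+1]≡[n+1]C[k+1])
open import Data.Nat.Solver using (module +-*-Solver)
open import Data.Vec using ([]; _∷_; lookup; updateAt)
open import Data.Fin using (Fin; zero; suc)
open import Data.Fin.Properties using (any?)
open import Data.Product using (∃; _,_; proj₁; proj₂)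
open import Data.Sum using (inj₁; inj₂)
open import Relation.Nullary using (yes; no; contradiction)
open import Relation.Binary.PropositionalEquality
  using (refl; sym; trans; cong; cong₂; subst; subst₂; module ≡-Reasoning)

open +-*-Solver

[1+n]C2≡n+nC2 : ∀ n → suc n C 2 ≡ n + n C 2
[1+n]C2≡n+nC2 n = begin
  suc n C 2        ≡⟨ nCk+nC[k+1]≡[n+1]C[k+1] n 1 ⟨
  n C 1 + n C 2    ≡⟨ cong (_+ n C 2) (nC1≡n n) ⟩
  n + n C 2        ∎
  where open ≡-Reasoning

nC2*2+n≡n*n : ∀ n → (n C 2) * 2 + n ≡ n * n
nC2*2+n≡n*n zero    = refl
nC2*2+n≡n*n (suc n) = begin
  (suc n C 2) * 2 + suc n           ≡⟨ cong (λ c → c * 2 + suc n) ([1+n]C2≡n+nC2 n) ⟩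
  (n + n C 2) * 2 + suc n           ≡⟨ regroup n (n C 2) ⟩
  ((n C 2) * 2 + n) + (suc n + n)   ≡⟨ cong (_+ (suc n + n)) (nC2*2+n≡n*n n) ⟩
  n * n + (suc n + n)               ≡⟨ square n ⟩
  suc n * suc n                     ∎
  where
  open ≡-Reasoning
  regroup : ∀ n c → (n + c) * 2 + suc n ≡ (c * 2 + n) + (suc n + n)
  regroup = solve 2 (λ n c → (n :+ c) :* con 2 :+ (con 1 :+ n)
                             := (c :* con 2 :+ n) :+ ((con 1 :+ n) :+ n)) refl
  square : ∀ n → n * n + (suc n + n) ≡ suc n * suc n
  square = solve 1 (λ n → n :* n :+ ((con 1 :+ n) :+ n) := (con 1 :+ n) :* (con 1 :+ n)) refl

[n*n∸n]/2≡nC2 : ∀ n → (n * n ∸ n) / 2 ≡ n C 2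
[n*n∸n]/2≡nC2 n = begin
  (n * n ∸ n) / 2              ≡⟨ cong (λ x → (x ∸ n) / 2) (nC2*2+n≡n*n n) ⟨
  ((n C 2) * 2 + n ∸ n) / 2    ≡⟨ cong (_/ 2) (m+n∸n≡m ((n C 2) * 2) n) ⟩
  (n C 2) * 2 / 2              ≡⟨ m*n/n≡m (n C 2) 2 ⟩
  n C 2                        ∎
  where open ≡-Reasoning

m≤n⇒m*n*2≤m*m+n*n : ∀ {m n} → m ≤ n → m * n * 2 ≤ m * m + n * n
m≤n⇒m*n*2≤m*m+n*n {m} {n} m≤n =
  subst (λ n → m * n * 2 ≤ m * m + n * n) (m+[n∸m]≡n m≤n)
        (subst (m * (m + d) * 2 ≤_) (square-gap m d) (m≤m+n _ (d * d)))
  where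
  d : ℕ
  d = n ∸ m
  square-gap : ∀ a d → a * (a + d) * 2 + d * d ≡ a * a + (a + d) * (a + d)
  square-gap = solve 2 (λ a d → a :* (a :+ d) :* con 2 :+ d :* d
                                := a :* a :+ (a :+ d) :* (a :+ d)) refl

m*n*2≤m*m+n*n : ∀ m n → m * n * 2 ≤ m * m + n * n
m*n*2≤m*m+n*n m n with ≤-total m n
... | inj₁ m≤n = m≤n⇒m*n*2≤m*m+n*n m≤n
... | inj₂ n≤m = subst₂ _≤_ (cong (_* 2) (*-comm n m)) (+-comm (n * n) (m * m))
                   (m≤n⇒m*n*2≤m*m+n*n n≤m)

requiredBudget : ℕ → ℕ → ℕ
requiredBudget k m = m C 2 + ((k C 2) ⊓ (k * m))

sum-updateAt-∸ : ∀ {k} (e : Vec ℕ k) (i : Fin k) {q} → q ≤ lookup e i →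
                 sum (updateAt e i (_∸ q)) + q ≡ sum e
sum-updateAt-∸ (x ∷ e) zero {q} q≤x = begin
  (x ∸ q) + sum e + q     ≡⟨ +-assoc (x ∸ q) (sum e) q ⟩
  (x ∸ q) + (sum e + q)   ≡⟨ cong ((x ∸ q) +_) (+-comm (sum e) q) ⟩
  (x ∸ q) + (q + sum e)   ≡⟨ +-assoc (x ∸ q) q (sum e) ⟨
  (x ∸ q) + q + sum e     ≡⟨ cong (_+ sum e) (m∸n+n≡m q≤x) ⟩
  x + sum e               ∎
  where open ≡-Reasoning
sum-updateAt-∸ (x ∷ e) (suc i) {q} q≤eᵢ =
  trans (+-assoc x _ q) (cong (x +_) (sum-updateAt-∸ e i q≤eᵢ))

all<⇒sum+k≤k*q : ∀ {k q} (e : Vec ℕ k) → (∀ i → lookup e i < q) → sum e + k ≤ k * q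
all<⇒sum+k≤k*q []      _    = z≤n
all<⇒sum+k≤k*q {suc k} {q} (x ∷ e) all< = begin
  x + sum e + suc k      ≡⟨ regroup x (sum e) k ⟩
  suc x + (sum e + k)    ≤⟨ +-mono-≤ (all< zero) (all<⇒sum+k≤k*q e (λ i → all< (suc i))) ⟩
  q + k * q              ∎
  where
  open ≤-Reasoning
  regroup : ∀ x s k → x + s + suc k ≡ suc x + (s + k)
  regroup = solve 3 (λ x s k → x :+ s :+ (con 1 :+ k) := (con 1 :+ x) :+ (s :+ k)) refl

k*q<[1+q]C2+kC2+k : ∀ k {q} → 1 ≤ q → k * q < suc q C 2 + k C 2 + k
k*q<[1+q]C2+kC2+k k {q} 1≤q = *-cancelʳ-< 2 _ _ (begin-strict
  k * q * 2                                       ≤⟨ m*n*2≤m*m+n*n k q ⟩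
  k * k + q * q                                   <⟨ m<m+n (k * k + q * q) (≤-trans 1≤q (m≤n+m q k)) ⟩
  k * k + q * q + (k + q)                         ≡⟨ cong₂ (λ a b → a + b + (k + q))
                                                           (nC2*2+n≡n*n k) (nC2*2+n≡n*n q) ⟨
  ((k C 2) * 2 + k) + ((q C 2) * 2 + q) + (k + q) ≡⟨ regroup k q (k C 2) (q C 2) ⟩
  (q + q C 2 + k C 2 + k) * 2                     ≡⟨ cong (λ c → (c + k C 2 + k) * 2)
                                                          ([1+n]C2≡n+nC2 q) ⟨
  (suc q C 2 + k C 2 + k) * 2                     ∎)
  where
  open ≤-Reasoning
  regroup : ∀ k q a b → (a * 2 + k) + (b * 2 + q) + (k + q) ≡ (q + b + a + k) * 2
  regroup = solve 4 (λ k q a b → (a :* con 2 :+ k) :+ (b :* con 2 :+ q) :+ (k :+ q)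
                                 := (q :+ b :+ a :+ k) :* con 2) refl

k*q<requiredBudget[1+q]+k : ∀ k {q} → 1 ≤ q → k * q < requiredBudget k (suc q) + k
k*q<requiredBudget[1+q]+k k {q} 1≤q with ⊓-sel (k C 2) (k * suc q)
... | inj₁ min≡kC2 =
  subst (λ c → k * q < suc q C 2 + c + k) (sym min≡kC2) (k*q<[1+q]C2+kC2+k k 1≤q)
... | inj₂ min≡k[1+q] = subst (λ c → k * q < suc q C 2 + c + k) (sym min≡k[1+q]) (begin-strict
  k * q                          <⟨ +-monoˡ-≤ (k * q) (≤-trans 1≤q (m≤m+n q (q C 2))) ⟩
  q + q C 2 + k * q              ≡⟨ cong (_+ k * q) ([1+n]C2≡n+nC2 q) ⟨
  suc q C 2 + k * q              ≤⟨ +-monoʳ-≤ (suc q C 2) (*-monoʳ-≤ k (n≤1+n q)) ⟩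
  suc q C 2 + k * suc q          ≤⟨ m≤m+n _ k ⟩
  suc q C 2 + k * suc q + k      ∎)
  where open ≤-Reasoning

requiredBudget⇒∃[q≤budget] : ∀ {k q} (e : Vec ℕ k) → 1 ≤ q →
                             requiredBudget k (suc q) ≤ sum e → ∃ λ i → q ≤ lookup e i
requiredBudget⇒∃[q≤budget] {k} {q} e 1≤q enough with any? (λ i → q ≤? lookup e i)
... | yes found = found
... | no  none  = contradiction (all<⇒sum+k≤k*q e all<) (<⇒≱ (begin-strict
  k * q                               <⟨ k*q<requiredBudget[1+q]+k k 1≤q ⟩
  requiredBudget k (suc q) + k        ≤⟨ +-monoˡ-≤ k enough ⟩
  sum e + k                           ∎))
  where
  open ≤-Reasoning
  all< : ∀ i → lookup e i < q
  all< i = ≰⇒> (λ q≤eᵢ → none (i , q≤eᵢ))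

requiredBudget-suc : ∀ k q → requiredBudget k q + q ≤ requiredBudget k (suc q)
requiredBudget-suc k q = begin
  q C 2 + ((k C 2) ⊓ (k * q)) + q       ≡⟨ +-comm (q C 2 + ((k C 2) ⊓ (k * q))) q ⟩
  q + (q C 2 + ((k C 2) ⊓ (k * q)))     ≡⟨ +-assoc q (q C 2) _ ⟨
  q + q C 2 + ((k C 2) ⊓ (k * q))       ≤⟨ +-mono-≤ (≤-reflexive (sym ([1+n]C2≡n+nC2 q)))
                                               (⊓-monoʳ-≤ (k C 2) (*-monoʳ-≤ k (n≤1+n q))) ⟩
  suc q C 2 + ((k C 2) ⊓ (k * suc q))   ∎
  where open ≤-Reasoning

requiredBudget⇒SimpleRun : ∀ {k} q (e : Vec ℕ k) → 1 ≤ q → requiredBudget k q ≤ sum e →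
                           SimpleRun q e
requiredBudget⇒SimpleRun (suc zero)    e _ _      = done
requiredBudget⇒SimpleRun {k} (suc (suc q)) e _ enough =
  step i q≤eᵢ (requiredBudget⇒SimpleRun (suc q) e′ (s≤s z≤n) still-enough)
  where
  open ≤-Reasoning
  colour : ∃ λ i → suc q ≤ lookup e i
  colour = requiredBudget⇒∃[q≤budget] e (s≤s z≤n) enough
  i : Fin k
  i = proj₁ colour
  q≤eᵢ : suc q ≤ lookup e i
  q≤eᵢ = proj₂ colour
  e′ : Vec ℕ k
  e′ = updateAt e i (_∸ suc q)
  still-enough : requiredBudget k (suc q) ≤ sum e′
  still-enough = +-cancelʳ-≤ (suc q) _ _ (begin
    requiredBudget k (suc q) + suc q    ≤⟨ requiredBudget-suc k (suc q) ⟩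
    requiredBudget k (suc (suc q))      ≤⟨ enough ⟩
    sum e                               ≡⟨ sum-updateAt-∸ e i q≤eᵢ ⟨
    sum e′ + suc q                      ∎)

lemma4p7 : (n k : ℕ) → 1 ≤ n → 1 ≤ k → (e : Vec ℕ k) → sum e ≡ n C 2 →
    (st : State k) → StdReach (initial n k e) st →
    (m : ℕ) → 2 ≤ m → m ∈ cliques st →
    (m C 2) + (((k * k ∸ k) / 2) ⊓ (k * m)) ≤ sum (budget st) →
    SimpleRun m (budget st)
lemma4p7 _ k _ _ _ _ st _ m 2≤m _ cushion =
  requiredBudget⇒SimpleRun m (budget st) (≤-trans (n≤1+n 1) 2≤m)
    (subst (λ c → m C 2 + (c ⊓ (k * m)) ≤ sum (budget st)) ([n*n∸n]/2≡nC2 k) cushion)
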